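{- Let $G$ be a connected finite balanced bipartite graph on at least four vertices such that $d(u)+d(v)>1+|N_2(u)\cup N(v)|$ for every pair of vertices $u,v\in V(G)$ with $d(u,v)=3$. Then the diameter of $G$ is at most $6$.
   Context: Graphs have no loops or multiple edges; $d(w)$ is the degree and $N(w)$ the neighbourhood of $w$, $d(u,v)$ the distance. $N_2(u)$ is the set of vertices at distance exactly $2$ from $u$. A bipartite graph is balanced if both colour classes have the same size. -}

module Defs where

open import Data.Nat using (ℕ; zero; suc; _+_; _≤_; _>_)
open import Data.Bool using (Bool; true; false; if_then_else_; _∧_; _∨_; not)
open import Data.Fin using (Fin; zero; suc)
open import Data.Fin.Properties using (_≟_)
open import Relation.Nullary.Decidable using (⌊_⌋)
open import Relation.Binary.PropositionalEquality using (_≡_)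
open import Data.Product using (Σ; ∃; _×_)

record Graph (n : ℕ) : Set where
  field
    adj     : Fin n → Fin n → Bool
    adj-sym : ∀ u v → adj u v ≡ adj v u
    loopless : ∀ u → adj u u ≡ false
open Graph public

count : {n : ℕ} → (Fin n → Bool) → ℕ
count {zero}  P = 0
count {suc n} P = (if P zero then 1 else 0) + count (λ i → P (suc i))

anyFin : {n : ℕ} → (Fin n → Bool) → Bool
anyFin {zero}  P = false
anyFin {suc n} P = P zero ∨ anyFin (λ i → P (suc i))

module _ {n : ℕ} (G : Graph n) where

  degree : Fin n → ℕ
  degree w = count (adj G w)

  -- reach k u w = true iff there is a walk of length at most k from u to w,
  -- i.e. iff d(u,w) ≤ k
  reach : ℕ → Fin n → Fin n → Bool
  reach zero    u w = ⌊ u ≟ w ⌋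
  reach (suc k) u w = ⌊ u ≟ w ⌋ ∨ anyFin (λ x → adj G u x ∧ reach k x w)

  distIs : ℕ → Fin n → Fin n → Bool
  distIs zero    u w = reach zero u w
  distIs (suc k) u w = reach (suc k) u w ∧ not (reach k u w)

  DistLe : ℕ → Fin n → Fin n → Set
  DistLe k u w = reach k u w ≡ true

  Connected : Set
  Connected = ∀ u v → ∃ λ k → DistLe k u v

  BalancedBipartite : Set
  BalancedBipartite =
    Σ (Fin n → Bool) λ c →
      (∀ u v → adj G u v ≡ true → c u ≡ not (c v)) ×
      (count c ≡ count (λ w → not (c w)))

  sizeN2uNv : Fin n → Fin n → ℕ
  sizeN2uNv u v = count (λ w → distIs 2 u w ∨ adj G v w)

  DiameterLe : ℕ → Set
  DiameterLe k = ∀ u v → DistLe k u v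

module Submission where

-- Suppose the diameter exceeds 6.  Since G is connected there is
-- then a pair u, z with d(u,z) = 7 exactly; on a shortest u–z path pick the
-- vertices p, q with d(u,p) = 3, pq an edge and d(q,z) = 3.
--
-- Degree-drop lemma: if d(u,v) = 3, t is a neighbour of u and d(v,t) ≥ 3,
-- then d(t) < d(u).  Indeed, by bipartiteness every neighbour of t other than
-- u lies in N_2(u), and since d(v,t) ≥ 3 none of them lies in N(v); hence
-- d(t) - 1 + d(v) ≤ |N_2(u) ∪ N(v)| < d(u) + d(v) - 1.
--
-- Applied to (u := p, v := u, t := q) and to (u := q, v := z, t := p) the
-- lemma gives d(q) < d(p) < d(q), a contradiction.

open import Defs
open import Data.Nat using (ℕ; zero; suc; _+_; _∸_; _≤_; _<_; _>_; s≤s; z≤n)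
open import Data.Nat.Properties
  using (+-comm; +-suc; m≤n⇒m≤1+n; m≤n+m; n≤1+n; ≤-refl; ≤-trans; m∸n+n≡m; +-cancelʳ-≤; <-asym; module ≤-Reasoning)
open import Data.Bool using (Bool; true; false; _∧_; _∨_; not; if_then_else_)
open import Data.Bool.Properties using (∨-zeroʳ; not-¬; ¬-not)
open import Data.Fin using (Fin; zero; suc)
open import Data.Fin.Properties using (_≟_; suc-injective)
open import Data.Product using (∃; _×_; _,_)
open import Data.Sum using (_⊎_; inj₁; inj₂)
open import Data.Empty using (⊥; ⊥-elim)
open import Relation.Nullary using (yes)
open import Relation.Nullary.Decidable using (⌊_⌋; isYes≗does; dec-true)
open import Relation.Binary.PropositionalEquality using (_≡_; _≢_; refl; sym; trans; cong; subst)

∨-true : ∀ a {b} → a ∨ b ≡ true → a ≡ true ⊎ b ≡ true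
∨-true true  _ = inj₁ refl
∨-true false p = inj₂ p

∧-true : ∀ a {b} → a ∧ b ≡ true → a ≡ true × b ≡ true
∧-true true p = refl , p

true-∧-true : ∀ {a b} → a ≡ true → b ≡ true → a ∧ b ≡ true
true-∧-true refl refl = refl

true≢false : true ≢ false
true≢false ()

anyFin-intro : ∀ {n} (P : Fin n → Bool) x → P x ≡ true → anyFin P ≡ true
anyFin-intro P zero    p rewrite p = refl
anyFin-intro P (suc x) p =
  trans (cong (P zero ∨_) (anyFin-intro (λ i → P (suc i)) x p)) (∨-zeroʳ _)

anyFin-elim : ∀ {n} (P : Fin n → Bool) → anyFin P ≡ true → ∃ λ x → P x ≡ true
anyFin-elim {suc n} P p with ∨-true (P zero) p
... | inj₁ q = zero , q
... | inj₂ q with anyFin-elim (λ i → P (suc i)) q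
...   | x , r = suc x , r

≟-refl : ∀ {n} (u : Fin n) → ⌊ u ≟ u ⌋ ≡ true
≟-refl u = trans (isYes≗does (u ≟ u)) (dec-true (u ≟ u) refl)

≟-sound : ∀ {n} (u w : Fin n) → ⌊ u ≟ w ⌋ ≡ true → u ≡ w
≟-sound u w p with u ≟ w
... | yes u≡w = u≡w

indicator-+-mono : ∀ a b {m k} → (a ≡ true → b ≡ true) → m ≤ k →
  (if a then 1 else 0) + m ≤ (if b then 1 else 0) + k
indicator-+-mono true  true  _   m≤k = s≤s m≤k
indicator-+-mono true  false a⇒b _   = ⊥-elim (true≢false (sym (a⇒b refl)))
indicator-+-mono false true  _   m≤k = m≤n⇒m≤1+n m≤k
indicator-+-mono false false _   m≤k = m≤k

count-mono : ∀ {n} (P Q : Fin n → Bool) → (∀ w → P w ≡ true → Q w ≡ true) → count P ≤ count Q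
count-mono {zero}  P Q f = z≤n
count-mono {suc n} P Q f =
  indicator-+-mono (P zero) (Q zero) (f zero) (count-mono _ _ (λ w → f (suc w)))

count-disjoint : ∀ {n} (P Q : Fin n → Bool) → (∀ w → P w ≡ true → Q w ≡ false) →
  count (λ w → P w ∨ Q w) ≡ count P + count Q
count-disjoint {zero}  P Q d = refl
count-disjoint {suc n} P Q d with P zero in ep | Q zero in eq
... | true  | true  = ⊥-elim (true≢false (trans (sym eq) (d zero ep)))
... | true  | false = cong suc (count-disjoint _ _ (λ w → d (suc w)))
... | false | true  =
  trans (cong suc (count-disjoint _ _ (λ w → d (suc w)))) (sym (+-suc _ _))
... | false | false = count-disjoint _ _ (λ w → d (suc w))

count-except : ∀ {n} (P Q : Fin n → Bool) (a : Fin n) →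
  (∀ w → w ≢ a → P w ≡ true → Q w ≡ true) → count P ≤ suc (count Q)
count-except {suc n} P Q zero f =
  indicator-+-mono (P zero) true (λ _ → refl)
    (≤-trans (count-mono _ _ (λ w → f (suc w) λ ())) (m≤n+m _ _))
count-except {suc n} P Q (suc a) f =
  subst (count P ≤_) (+-suc (if Q zero then 1 else 0) _)
    (indicator-+-mono (P zero) (Q zero) (f zero λ ())
      (count-except _ _ a (λ w w≢a → f (suc w) (λ e → w≢a (suc-injective e)))))

module _ {n : ℕ} (G : Graph n) where

  reach-step : ∀ k u x w → adj G u x ≡ true → reach G k x w ≡ true → reach G (suc k) u w ≡ true
  reach-step k u x w ux xw =
    trans (cong (⌊ u ≟ w ⌋ ∨_) (anyFin-intro (λ y → adj G u y ∧ reach G k y w) x (true-∧-true ux xw)))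
          (∨-zeroʳ _)

  reach-decomp : ∀ k u w → reach G (suc k) u w ≡ true →
    u ≡ w ⊎ ∃ λ x → adj G u x ≡ true × reach G k x w ≡ true
  reach-decomp k u w p with ∨-true ⌊ u ≟ w ⌋ p
  ... | inj₁ q = inj₁ (≟-sound u w q)
  ... | inj₂ q with anyFin-elim (λ y → adj G u y ∧ reach G k y w) q
  ...   | x , r = inj₂ (x , ∧-true _ r)

  reach-refl : ∀ k u → reach G k u u ≡ true
  reach-refl zero    u = ≟-refl u
  reach-refl (suc k) u rewrite ≟-refl u = refl

  reach-zero : ∀ u w → reach G 0 u w ≡ true → u ≡ w
  reach-zero = ≟-sound

  reach-edge : ∀ u w → adj G u w ≡ true → reach G 1 u w ≡ true
  reach-edge u w uw = reach-step 0 u w w uw (reach-refl 0 w)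

  reach-one : ∀ u w → reach G 1 u w ≡ true → u ≡ w ⊎ adj G u w ≡ true
  reach-one u w p with reach-decomp 0 u w p
  ... | inj₁ u≡w = inj₁ u≡w
  ... | inj₂ (x , ux , xw) with reach-zero x w xw
  ...   | refl = inj₂ ux

  reach-suc : ∀ k u w → reach G k u w ≡ true → reach G (suc k) u w ≡ true
  reach-suc zero    u w p with reach-zero u w p
  ... | refl = reach-refl 1 u
  reach-suc (suc k) u w p with reach-decomp k u w p
  ... | inj₁ refl = reach-refl (suc (suc k)) u
  ... | inj₂ (x , ux , xw) = reach-step (suc k) u x w ux (reach-suc k x w xw)

  reach-weaken : ∀ j k u w → reach G k u w ≡ true → reach G (j + k) u w ≡ true
  reach-weaken zero    k u w p = p
  reach-weaken (suc j) k u w p = reach-suc (j + k) u w (reach-weaken j k u w p)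

  reach-mono : ∀ {k m} u w → k ≤ m → reach G k u w ≡ true → reach G m u w ≡ true
  reach-mono {k} {m} u w k≤m p =
    subst (λ l → reach G l u w ≡ true) (m∸n+n≡m k≤m) (reach-weaken (m ∸ k) k u w p)

  reach-trans : ∀ a b x y z → reach G a x y ≡ true → reach G b y z ≡ true → reach G (a + b) x z ≡ true
  reach-trans zero    b x y z p q with reach-zero x y p
  ... | refl = q
  reach-trans (suc a) b x y z p q with reach-decomp a x y p
  ... | inj₁ refl = reach-weaken (suc a) b x z q
  ... | inj₂ (w , xw , wy) = reach-step (a + b) x w z xw (reach-trans a b w y z wy q)

  reach-sym : ∀ k u w → reach G k u w ≡ true → reach G k w u ≡ true
  reach-sym zero    u w p with reach-zero u w p
  ... | refl = reach-refl 0 u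
  reach-sym (suc k) u w p with reach-decomp k u w p
  ... | inj₁ refl = reach-refl (suc k) u
  ... | inj₂ (x , ux , xw) =
    subst (λ m → reach G m w u ≡ true) (+-comm k 1)
      (reach-trans k 1 w x u (reach-sym k x w xw) (reach-edge x u (trans (adj-sym G x u) ux)))

  reach-split : ∀ a b x z → reach G (a + b) x z ≡ true →
    ∃ λ m → reach G a x m ≡ true × reach G b m z ≡ true
  reach-split zero    b x z p = x , reach-refl 0 x , p
  reach-split (suc a) b x z p with reach-decomp (a + b) x z p
  ... | inj₁ refl = x , reach-refl (suc a) x , reach-refl b x
  ... | inj₂ (w , xw , wz) with reach-split a b w z wz
  ...   | m , xm , mz = m , reach-step a x w m xw xm , mz

  exact-distance : ∀ j k x y → reach G j x y ≡ true → reach G k x y ≡ false →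
    ∃ λ z → reach G (suc k) x z ≡ true × reach G k x z ≡ false
  exact-distance zero    k x y p q with reach-zero x y p
  ... | refl = ⊥-elim (true≢false (trans (sym (reach-refl k x)) q))
  exact-distance (suc j) k x y p q
    with reach-split j 1 x y (subst (λ m → reach G m x y ≡ true) (+-comm 1 j) p)
  ... | m , xm , my with reach G k x m in e
  ...   | false = exact-distance j k x m xm e
  ...   | true  = y , subst (λ l → reach G l x y ≡ true) (+-comm k 1) (reach-trans k 1 x m y e my) , q

  distIs-intro : ∀ k u v → reach G (suc k) u v ≡ true → reach G k u v ≡ false → distIs G (suc k) u v ≡ true
  distIs-intro k u v p q rewrite p | q = refl

  beyond-walk : ∀ {k} u z → reach G k u z ≡ false →
    ∀ a b x → a + b ≤ k → reach G a u x ≡ true → reach G b x z ≡ true → ⊥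
  beyond-walk u z beyond a b x ab≤k ux xz =
    true≢false (trans (sym (reach-mono u z ab≤k (reach-trans a b u x z ux xz))) beyond)

  module _ (col : Fin n → Bool) (proper : ∀ u v → adj G u v ≡ true → col u ≡ not (col v)) where

    no-triangle : ∀ u t w → adj G u t ≡ true → adj G t w ≡ true → adj G u w ≡ false
    no-triangle u t w ut tw = ¬-not λ uw →
      not-¬ refl (trans (proper u t ut) (cong not (trans (proper t w tw) (sym (proper u w uw)))))

    second-neighbour : ∀ u t w → adj G u t ≡ true → adj G t w ≡ true → w ≢ u → distIs G 2 u w ≡ true
    second-neighbour u t w ut tw w≢u =
      distIs-intro 1 u w (reach-step 1 u t w ut (reach-edge t w tw)) (¬-not not-within-one)
      where
        not-within-one : reach G 1 u w ≢ true
        not-within-one r with reach-one u w r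
        ... | inj₁ u≡w = w≢u (sym u≡w)
        ... | inj₂ uw  = true≢false (trans (sym uw) (no-triangle u t w ut tw))

    module _ (ore : ∀ u v → distIs G 3 u v ≡ true → degree G u + degree G v > 1 + sizeN2uNv G u v) where

      -- Degree drop: if d(u,v) = 3, t ∈ N(u) and d(v,t) ≥ 3, then d(t) < d(u),
      -- because N(t) ∖ {u} ⊆ N_2(u) and N(t) ∩ N(v) = ∅.
      degree-drop : ∀ u v t → distIs G 3 u v ≡ true → adj G u t ≡ true → reach G 2 v t ≡ false →
        degree G t < degree G u
      degree-drop u v t uv ut vt = +-cancelʳ-≤ (degree G v) (suc (degree G t)) (degree G u)
        (≤-trans (s≤s neighbourhoods-bound) (ore u v uv))
        where
          open ≤-Reasoning

          disjoint : ∀ w → adj G t w ≡ true → adj G v w ≡ false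
          disjoint w tw = ¬-not λ vw →
            true≢false (trans (sym (reach-step 1 v w t vw (reach-edge w t (trans (adj-sym G w t) tw)))) vt)

          covered : ∀ w → w ≢ u → (adj G t w ∨ adj G v w) ≡ true → (distIs G 2 u w ∨ adj G v w) ≡ true
          covered w w≢u p with ∨-true (adj G t w) p
          ... | inj₁ tw = cong (_∨ adj G v w) (second-neighbour u t w ut tw w≢u)
          ... | inj₂ vw rewrite vw = ∨-zeroʳ _

          neighbourhoods-bound : degree G t + degree G v ≤ suc (sizeN2uNv G u v)
          neighbourhoods-bound = begin
            degree G t + degree G v             ≡⟨ sym (count-disjoint (adj G t) (adj G v) disjoint) ⟩
            count (λ w → adj G t w ∨ adj G v w) ≤⟨ count-except _ _ u covered ⟩
            suc (sizeN2uNv G u v)               ∎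

      -- No vertex lies at distance exactly 7 from another: split a shortest
      -- u–z path as u →3 p — q →3 z and apply the degree drop twice.
      no-distance-seven : ∀ u z → reach G 7 u z ≡ true → reach G 6 u z ≡ false → ⊥
      no-distance-seven u z uz beyond with reach-split 3 4 u z uz
      ... | p , up , pz with reach-decomp 3 p z pz
      ...   | inj₁ refl = beyond-walk {6} u _ beyond 3 0 _ (s≤s (s≤s (s≤s z≤n))) up (reach-refl 0 p)
      ...   | inj₂ (q , pq , qz) = <-asym (degree-drop p u q pu pq uq) (degree-drop q z p qz′ qp zp)
        where
          -- Each hypothesis of the two degree drops holds because otherwise
          -- u and z would be joined by a walk of length at most 6.
          pu : distIs G 3 p u ≡ true
          pu = distIs-intro 2 p u (reach-sym 3 u p up)
                 (¬-not λ r → beyond-walk u z beyond 2 4 p ≤-refl (reach-sym 2 p u r) pz)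
          uq : reach G 2 u q ≡ false
          uq = ¬-not λ r → beyond-walk u z beyond 2 3 q (n≤1+n 5) r qz
          qz′ : distIs G 3 q z ≡ true
          qz′ = distIs-intro 2 q z qz
                  (¬-not λ r → beyond-walk u z beyond 4 2 q ≤-refl (reach-trans 3 1 u p q up (reach-edge p q pq)) r)
          qp : adj G q p ≡ true
          qp = trans (adj-sym G q p) pq
          zp : reach G 2 z p ≡ false
          zp = ¬-not λ r → beyond-walk u z beyond 3 2 p (n≤1+n 5) up (reach-sym 2 z p r)

proposition13 : (n : ℕ) (G : Graph n) → 4 ≤ n → Connected G → BalancedBipartite G →
    (∀ u v → distIs G 3 u v ≡ true → degree G u + degree G v > 1 + sizeN2uNv G u v) →
    DiameterLe G 6
proposition13 n G _ connected (col , proper , _) ore u v = ¬-not λ beyond-six →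
  let (k , within-k) = connected u v
      (z , within-seven , beyond-six′) = exact-distance G k 6 u v within-k beyond-six
  in no-distance-seven G col proper ore u z within-seven beyond-six′
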